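{- Let $\mathcal{V}$ be a finite set and $\mathcal{F}$ a finite family of subsets of $\mathcal{V}$. Let $P_f$ be the ordered partition of $\mathcal{V}$ obtained from the one-part partition $P_{\mathcal{V}}=(\mathcal{V})$ by refining successively by every set of $\mathcal{F}$ taken in $LF$ order. Then listing the elements of $\mathcal{V}$ part by part in the order of the parts of $P_f$ (elements inside a part in any order) lists the columns of the matrix $BM$ in (non-decreasing) lexicographic order.
   Context: $LF$ is the list of all sets of $\mathcal{F}$ sorted in decreasing order of size, ties broken in an arbitrary but fixed way. An ordered partition of $\mathcal{V}$ is a sequence of disjoint nonempty parts whose union is $\mathcal{V}$. Refining a part $C$ by a set $X$: if $C\subseteq X$ or $C\cap X=\emptyset$, $C$ is unchanged; otherwise $C$ is replaced, at its position in the sequence, by the two parts $C'=C\setminus X$ followed by $C''=C\cap X$. Refining an ordered partition by $X$ means refining each of its parts by $X$. $BM$ is the boolean matrix with one row per set of $\mathcal{F}$ in $LF$ order (top to bottom) and one column per element $v\in\mathcal{V}$, the entry being $1$ iff $v$ belongs to the row's set. A column is read as the $0/1$ word of its entries from the top row to the bottom row, and lexicographic order uses $0<1$. -}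

module Defs where

open import Data.Bool using (Bool; true; false; not; if_then_else_)
import Data.Bool as B
open import Data.Nat using (ℕ; _≤_)
open import Data.Fin using (Fin)
open import Data.Fin.Subset using (Subset; ∣_∣)
open import Data.Vec using (lookup)
open import Data.List using (List; []; _∷_; filter; concatMap; map; foldl; allFin)
open import Data.List.Relation.Unary.Linked using (Linked)
open import Data.List.Relation.Binary.Lex.NonStrict using (Lex-≤)
open import Relation.Binary.PropositionalEquality using (_≡_)
open import Relation.Nullary.Decidable using (does)
open import Data.Bool.Properties using (T?)

-- V = Fin n ; a subset X of V is 'Subset n' (a Bool vector), v ∈ X iff lookup X v ≡ true.
mem : ∀ {n} → Subset n → Fin n → Bool
mem X v = lookup X v

OPartition : ℕ → Set
OPartition n = List (List (Fin n))

allB : ∀ {A : Set} → (A → Bool) → List A → Bool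
allB p [] = true
allB p (x ∷ xs) = p x B.∧ allB p xs

refinePart : ∀ {n} → Subset n → List (Fin n) → OPartition n
refinePart X C =
  if allB (mem X) C then (C ∷ [])
  else (if allB (λ v → not (mem X v)) C then (C ∷ [])
  else (filter (λ v → T? (not (mem X v))) C ∷ filter (λ v → T? (mem X v)) C ∷ []))

refine : ∀ {n} → OPartition n → Subset n → OPartition n
refine P X = concatMap (refinePart X) P

onePart : ∀ n → OPartition n
onePart n = allFin n ∷ []

finalPartition : ∀ {n} → List (Subset n) → OPartition n
finalPartition {n} LF = foldl refine (onePart n) LF

DecreasingSize : ∀ {n} → List (Subset n) → Set
DecreasingSize = Linked (λ X Y → ∣ Y ∣ ≤ ∣ X ∣)

-- Column of BM for element v: membership of v in each row set, top to bottom.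
column : ∀ {n} → List (Subset n) → Fin n → List Bool
column LF v = map (λ X → mem X v) LF

_≤lex_ : List Bool → List Bool → Set
_≤lex_ = Lex-≤ _≡_ B._≤_

ColumnsSorted : ∀ {n} → List (Subset n) → List (Fin n) → Set
ColumnsSorted LF vs = Linked (λ u v → column LF u ≤lex column LF v) vs

-- After refining by the first k rows of BM, every part consists of elements
-- whose columns agree on those k rows, and the parts are listed in strictly
-- increasing lexicographic order of these k-bit prefixes. Refining by the next
-- row appends one bit to every column: between different parts the order is
-- already decided on the prefix, and a part that splits puts its 0-elements
-- before its 1-elements.
module Submission where

open import Defs
open import Data.Nat using (ℕ)
open import Data.Fin using (Fin)
open import Data.Fin.Subset using (Subset)
open import Data.List using (List; concat)
open import Data.List.Relation.Binary.Permutation.Propositional using (_↭_)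
open import Data.List.Relation.Binary.Pointwise using (Pointwise)

open import Function using (_∘_)
open import Data.Bool using (Bool; true; false; not)
import Data.Bool as Bool
open import Data.Bool.Properties using (T?; not-injective; T-≡)
open import Data.Product using (_×_; _,_; proj₁; proj₂)
open import Data.Sum using () renaming ([_,_] to either)
open import Data.List using ([]; _∷_; [_]; _++_; _∷ʳ_; filter; foldl)
open import Data.List.Properties using (map-++; concat-++; ++-assoc; ++-identityʳ)
open import Data.List.Membership.Propositional using (_∈_)
open import Data.List.Membership.Propositional.Properties using (∈-++⁻; ∈-filter⁻)
open import Data.List.Relation.Unary.Any using (here; there)
import Data.List.Relation.Unary.All as All
open import Data.List.Relation.Unary.AllPairs using (AllPairs; []; _∷_)
import Data.List.Relation.Unary.AllPairs.Properties as AllPairs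
open import Data.List.Relation.Unary.Linked.Properties using (AllPairs⇒Linked)
open import Data.List.Relation.Binary.Pointwise using ([]; _∷_; ≡⇒Pointwise-≡)
open import Data.List.Relation.Binary.Permutation.Propositional using (↭-sym)
open import Data.List.Relation.Binary.Subset.Propositional using (_⊆_)
open import Data.List.Relation.Binary.Subset.Propositional.Properties
  using (⊆-reflexive; ⊆-reflexive-↭; xs⊆xs++ys; xs⊆ys++xs)
import Data.List.Relation.Binary.Subset.Propositional.Properties as ⊆
import Data.List.Relation.Binary.Lex.Core as Lex
open import Data.List.Relation.Binary.Lex.NonStrict using (≤-reflexive)
open import Relation.Binary.PropositionalEquality
  using (_≡_; refl; sym; trans; cong₂; subst; subst₂; module ≡-Reasoning)
open import Function.Bundles using (Equivalence)

infix 4 _<lex_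

-- Strict lexicographic order for words of equal length. Unlike Lex-<, it has
-- no case for a proper prefix, so it survives appending arbitrary suffixes.
data _<lex_ : List Bool → List Bool → Set where
  this : ∀ {xs ys} → false ∷ xs <lex true ∷ ys
  next : ∀ {b xs ys} → xs <lex ys → b ∷ xs <lex b ∷ ys

<lex-++ : ∀ {xs ys} zs ws → xs <lex ys → xs ++ zs <lex ys ++ ws
<lex-++ zs ws this     = this
<lex-++ zs ws (next p) = next (<lex-++ zs ws p)

∷ʳ-false<lex∷ʳ-true : ∀ xs → xs ∷ʳ false <lex xs ∷ʳ true
∷ʳ-false<lex∷ʳ-true []       = this
∷ʳ-false<lex∷ʳ-true (x ∷ xs) = next (∷ʳ-false<lex∷ʳ-true xs)

<lex⇒≤lex : ∀ {xs ys} → xs <lex ys → xs ≤lex ys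
<lex⇒≤lex this     = Lex.this (Bool.f≤t , λ ())
<lex⇒≤lex (next p) = Lex.next refl (<lex⇒≤lex p)

≡⇒≤lex : ∀ {xs ys} → xs ≡ ys → xs ≤lex ys
≡⇒≤lex eq = ≤-reflexive _≡_ Bool._≤_ (≡⇒Pointwise-≡ eq)

allB-sound : ∀ {A : Set} (p : A → Bool) xs → allB p xs ≡ true → ∀ {x} → x ∈ xs → p x ≡ true
allB-sound p (x ∷ xs) eq (here refl) with p x | eq
... | true | _ = refl
allB-sound p (x ∷ xs) eq (there x∈xs) with p x | eq
... | true | eq′ = allB-sound p xs eq′ x∈xs

∈-filter-T⁻ : ∀ {A : Set} (p : A → Bool) xs {x} → x ∈ filter (λ y → T? (p y)) xs → x ∈ xs × p x ≡ true
∈-filter-T⁻ p xs x∈ with ∈-filter⁻ (λ y → T? (p y)) x∈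
... | x∈xs , px = x∈xs , Equivalence.to T-≡ px

module _ {n : ℕ} where

  column-∷ʳ : ∀ (A : List (Subset n)) X v → column (A ∷ʳ X) v ≡ column A v ∷ʳ mem X v
  column-∷ʳ A X v = map-++ (λ Y → mem Y v) A [ X ]

  Homogeneous : List (Subset n) → List (Fin n) → Set
  Homogeneous A C = ∀ {u v} → u ∈ C → v ∈ C → column A u ≡ column A v

  Precedes : List (Subset n) → List (Fin n) → List (Fin n) → Set
  Precedes A C D = ∀ {u v} → u ∈ C → v ∈ D → column A u <lex column A v

  Homogeneous-mono : ∀ {A C C′} → C′ ⊆ C → Homogeneous A C → Homogeneous A C′
  Homogeneous-mono C′⊆C hom u∈ v∈ = hom (C′⊆C u∈) (C′⊆C v∈)

  Precedes-mono : ∀ {A C C′ D D′} → C′ ⊆ C → D′ ⊆ D → Precedes A C D → Precedes A C′ D′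
  Precedes-mono C′⊆C D′⊆D prec u∈ v∈ = prec (C′⊆C u∈) (D′⊆D v∈)

  Precedes-++ : ∀ {A C D E} → Precedes A C D → Precedes A C E → Precedes A C (D ++ E)
  Precedes-++ {D = D} precD precE u∈ v∈ = either (precD u∈) (precE u∈) (∈-++⁻ D v∈)

  Homogeneous-∷ʳ : ∀ {A C} X b → (∀ {v} → v ∈ C → mem X v ≡ b) →
                   Homogeneous A C → Homogeneous (A ∷ʳ X) C
  Homogeneous-∷ʳ {A} X b constant hom {u} {v} u∈ v∈ = begin
    column (A ∷ʳ X) u       ≡⟨ column-∷ʳ A X u ⟩
    column A u ∷ʳ mem X u   ≡⟨ cong₂ _∷ʳ_ (hom u∈ v∈) (trans (constant u∈) (sym (constant v∈))) ⟩
    column A v ∷ʳ mem X v   ≡⟨ column-∷ʳ A X v ⟨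
    column (A ∷ʳ X) v       ∎
    where open ≡-Reasoning

  Precedes-∷ʳ : ∀ {A C D} X → Precedes A C D → Precedes (A ∷ʳ X) C D
  Precedes-∷ʳ {A} X prec {u} {v} u∈ v∈ =
    subst₂ _<lex_ (sym (column-∷ʳ A X u)) (sym (column-∷ʳ A X v))
      (<lex-++ _ _ (prec u∈ v∈))

  Precedes-split : ∀ {A C C₀ C₁} X → Homogeneous A C → C₀ ⊆ C → C₁ ⊆ C →
                   (∀ {v} → v ∈ C₀ → mem X v ≡ false) → (∀ {v} → v ∈ C₁ → mem X v ≡ true) →
                   Precedes (A ∷ʳ X) C₀ C₁
  Precedes-split {A} X hom C₀⊆C C₁⊆C out in₁ {u} {v} u∈ v∈ =
    subst₂ _<lex_ (sym column-u) (sym column-v) (∷ʳ-false<lex∷ʳ-true (column A v))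
    where
    column-u : column (A ∷ʳ X) u ≡ column A v ∷ʳ false
    column-u = trans (column-∷ʳ A X u) (cong₂ _∷ʳ_ (hom (C₀⊆C u∈) (C₁⊆C v∈)) (out u∈))
    column-v : column (A ∷ʳ X) v ≡ column A v ∷ʳ true
    column-v = trans (column-∷ʳ A X v) (cong₂ _∷ʳ_ refl (in₁ v∈))

  data ColumnOrdered (A : List (Subset n)) : OPartition n → Set where
    []   : ColumnOrdered A []
    cons : ∀ {C P} → Homogeneous A C → Precedes A C (concat P) →
           ColumnOrdered A P → ColumnOrdered A (C ∷ P)

  ColumnOrdered-++ : ∀ {A P Q} → ColumnOrdered A P → ColumnOrdered A Q →
                     Precedes A (concat P) (concat Q) → ColumnOrdered A (P ++ Q)
  ColumnOrdered-++ [] oQ prec = oQ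
  ColumnOrdered-++ {A} {C ∷ P} {Q} (cons hom precP oP) oQ prec =
    cons hom
      (subst (Precedes A C) (concat-++ P Q)
        (Precedes-++ precP (Precedes-mono (xs⊆xs++ys C (concat P)) (λ v∈ → v∈) prec)))
      (ColumnOrdered-++ oP oQ (Precedes-mono (xs⊆ys++xs (concat P) C) (λ v∈ → v∈) prec))

  data Refinement (X : Subset n) (C : List (Fin n)) : OPartition n → Set where
    unsplit : ∀ b → (∀ {v} → v ∈ C → mem X v ≡ b) → Refinement X C (C ∷ [])
    split   : ∀ {C₀ C₁} → C₀ ⊆ C → C₁ ⊆ C →
              (∀ {v} → v ∈ C₀ → mem X v ≡ false) → (∀ {v} → v ∈ C₁ → mem X v ≡ true) →
              Refinement X C (C₀ ∷ C₁ ∷ [])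

  refinePart-refinement : ∀ X C → Refinement X C (refinePart X C)
  refinePart-refinement X C with allB (mem X) C in all∈X
  ... | true = unsplit true (allB-sound (mem X) C all∈X)
  ... | false with allB (λ v → not (mem X v)) C in all∉X
  ... | true  = unsplit false (not-injective ∘ allB-sound (λ v → not (mem X v)) C all∉X)
  ... | false = split (proj₁ ∘ ∈-filter-T⁻ (λ v → not (mem X v)) C) (proj₁ ∘ ∈-filter-T⁻ (mem X) C)
                      (not-injective ∘ proj₂ ∘ ∈-filter-T⁻ (λ v → not (mem X v)) C)
                      (proj₂ ∘ ∈-filter-T⁻ (mem X) C)

  concat-refinement-⊆ : ∀ {X C P} → Refinement X C P → concat P ⊆ C
  concat-refinement-⊆ {C = C} (unsplit _ _) = ⊆-reflexive (++-identityʳ C)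
  concat-refinement-⊆ (split {C₀} {C₁} C₀⊆C C₁⊆C _ _) =
    either C₀⊆C (C₁⊆C ∘ ⊆-reflexive (++-identityʳ C₁)) ∘ ∈-++⁻ C₀

  concat-refine-⊆ : ∀ X P → concat (refine P X) ⊆ concat P
  concat-refine-⊆ X []      = λ ()
  concat-refine-⊆ X (C ∷ P) =
    subst (_⊆ C ++ concat P) (concat-++ (refinePart X C) (refine P X))
      (⊆.++⁺ (concat-refinement-⊆ (refinePart-refinement X C)) (concat-refine-⊆ X P))

  refinement-ordered : ∀ {A X C P} → Refinement X C P → Homogeneous A C → ColumnOrdered (A ∷ʳ X) P
  refinement-ordered {X = X} (unsplit b constant) hom =
    cons (Homogeneous-∷ʳ X b constant hom) (λ _ ()) []
  refinement-ordered {X = X} (split {C₁ = C₁} C₀⊆C C₁⊆C out in₁) hom =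
    cons (Homogeneous-∷ʳ X false out (Homogeneous-mono C₀⊆C hom))
         (Precedes-mono (λ u∈ → u∈) (⊆-reflexive (++-identityʳ C₁))
           (Precedes-split X hom C₀⊆C C₁⊆C out in₁))
         (cons (Homogeneous-∷ʳ X true in₁ (Homogeneous-mono C₁⊆C hom)) (λ _ ()) [])

  refine-ordered : ∀ {A P} X → ColumnOrdered A P → ColumnOrdered (A ∷ʳ X) (refine P X)
  refine-ordered X [] = []
  refine-ordered X (cons {C} {P} hom prec oP) =
    ColumnOrdered-++ (refinement-ordered (refinePart-refinement X C) hom) (refine-ordered X oP)
      (Precedes-∷ʳ X (Precedes-mono (concat-refinement-⊆ (refinePart-refinement X C))
                                    (concat-refine-⊆ X P) prec))

  foldl-refine-ordered : ∀ A R {P} → ColumnOrdered A P → ColumnOrdered (A ++ R) (foldl refine P R)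
  foldl-refine-ordered A [] oP = subst (λ B → ColumnOrdered B _) (sym (++-identityʳ A)) oP
  foldl-refine-ordered A (X ∷ R) oP =
    subst (λ B → ColumnOrdered B _) (++-assoc A [ X ] R)
      (foldl-refine-ordered (A ∷ʳ X) R (refine-ordered X oP))

  onePart-ordered : ColumnOrdered [] (onePart n)
  onePart-ordered = cons (λ _ _ → refl) (λ _ ()) []

  concat-⊇ : ∀ {P Q : OPartition n} → Pointwise _↭_ P Q → concat Q ⊆ concat P
  concat-⊇ []         = λ ()
  concat-⊇ (C↭D ∷ ps) = ⊆.++⁺ (⊆-reflexive-↭ (↭-sym C↭D)) (concat-⊇ ps)

  ColumnOrdered-resp-↭ : ∀ {A P Q} → Pointwise _↭_ P Q → ColumnOrdered A P → ColumnOrdered A Q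
  ColumnOrdered-resp-↭ []         []                 = []
  ColumnOrdered-resp-↭ (C↭D ∷ ps) (cons hom prec oP) =
    cons (Homogeneous-mono (⊆-reflexive-↭ (↭-sym C↭D)) hom)
         (Precedes-mono (⊆-reflexive-↭ (↭-sym C↭D)) (concat-⊇ ps) prec)
         (ColumnOrdered-resp-↭ ps oP)

  ColumnLeq : List (Subset n) → Fin n → Fin n → Set
  ColumnLeq A u v = column A u ≤lex column A v

  Homogeneous⇒AllPairs : ∀ {A} C → Homogeneous A C → AllPairs (ColumnLeq A) C
  Homogeneous⇒AllPairs []      hom = []
  Homogeneous⇒AllPairs (u ∷ C) hom =
    All.tabulate (λ v∈C → ≡⇒≤lex (hom (here refl) (there v∈C)))
    ∷ Homogeneous⇒AllPairs C (λ u∈ v∈ → hom (there u∈) (there v∈))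

  ColumnOrdered⇒AllPairs : ∀ {A P} → ColumnOrdered A P → AllPairs (ColumnLeq A) (concat P)
  ColumnOrdered⇒AllPairs []                         = []
  ColumnOrdered⇒AllPairs (cons {C} hom prec oP) =
    AllPairs.++⁺ (Homogeneous⇒AllPairs C hom) (ColumnOrdered⇒AllPairs oP)
      (All.tabulate λ u∈ → All.tabulate λ v∈ → <lex⇒≤lex (prec u∈ v∈))

lemma7 : (n : ℕ) (F LF : List (Subset n)) → LF ↭ F → DecreasingSize LF →
    (Q : List (List (Fin n))) → Pointwise _↭_ (finalPartition LF) Q →
    ColumnsSorted LF (concat Q)
lemma7 n F LF _ _ Q P↭Q =
  AllPairs⇒Linked
    (ColumnOrdered⇒AllPairs
      (ColumnOrdered-resp-↭ P↭Q (foldl-refine-ordered [] LF onePart-ordered)))
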